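{- For every $n\ge1$, the constraint graph of the Haken–Luby VCSP instance has pathwidth exactly $3$.
   Context: The Haken–Luby instance has variables $\{(k,i): k\in[n], i\in[7]\}$. Its constraint graph has an edge between two variables iff there is a binary constraint on them, namely the edges, for each $k\in[n]$: $\{(k,1),(k,2)\}$, $\{(k,1),(k,3)\}$, $\{(k,2),(k,4)\}$, $\{(k,3),(k,6)\}$, $\{(k,4),(k,5)\}$, $\{(k,6),(k,5)\}$, $\{(k,4),(k,7)\}$, $\{(k,6),(k,7)\}$, $\{(k,5),(k,7)\}$, and, for $k\ge2$, $\{(k,7),(k-1,1)\}$. -}

module Defs where

open import Level using (Level; _⊔_; suc)
open import Data.Nat using (ℕ; _≤_) renaming (suc to sucℕ)
open import Data.Fin using (Fin; toℕ) renaming (_≤_ to _≤ᶠ_)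
open import Data.Product using (_×_; ∃; Σ; _,_)
open import Data.List using (List; length)
open import Data.List.Membership.Propositional using (_∈_)
open import Data.List.Relation.Unary.Unique.Propositional using (Unique)
open import Relation.Binary.PropositionalEquality using (_≡_)

-- Path decompositions and pathwidth of a graph given by a vertex type V
-- and an (undirected) edge relation E (an edge {u,v} may be listed in
-- either orientation; the conditions below are symmetric in u, v).

record PathDecomposition {a b : Level} (V : Set a) (E : V → V → Set b) : Set (a ⊔ b) where
  field
    len             : ℕ
    bag             : Fin len → List V
    bag-unique      : ∀ i → Unique (bag i)
    covers-vertices : ∀ v → ∃ λ i → v ∈ bag i
    covers-edges    : ∀ u v → E u v → ∃ λ i → (u ∈ bag i) × (v ∈ bag i)
    contiguous      : ∀ v {i j k : Fin len} → i ≤ᶠ j → j ≤ᶠ k →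
                      v ∈ bag i → v ∈ bag k → v ∈ bag j

open PathDecomposition public

WidthAtMost : {a b : Level} {V : Set a} {E : V → V → Set b} →
              PathDecomposition V E → ℕ → Set
WidthAtMost D w = ∀ i → length (bag D i) ≤ sucℕ w

PathwidthIs : {a b : Level} (V : Set a) (E : V → V → Set b) → ℕ → Set (a ⊔ b)
PathwidthIs V E p =
  (Σ (PathDecomposition V E) λ D → WidthAtMost D p) ×
  (∀ (D : PathDecomposition V E) (w : ℕ) → WidthAtMost D w → p ≤ w)

-- The Haken–Luby constraint graph.
-- Variable (k,i), k ∈ [n], i ∈ [7], is represented as (k', i') : Fin n × Fin 7
-- with k' = k-1 and i' = i-1 (0-indexed).

HLVar : ℕ → Set
HLVar n = Fin n × Fin 7

x1 x2 x3 x4 x5 x6 x7 : Fin 7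
x1 = Fin.zero
x2 = Fin.suc Fin.zero
x3 = Fin.suc (Fin.suc Fin.zero)
x4 = Fin.suc (Fin.suc (Fin.suc Fin.zero))
x5 = Fin.suc (Fin.suc (Fin.suc (Fin.suc Fin.zero)))
x6 = Fin.suc (Fin.suc (Fin.suc (Fin.suc (Fin.suc Fin.zero))))
x7 = Fin.suc (Fin.suc (Fin.suc (Fin.suc (Fin.suc (Fin.suc Fin.zero)))))

data HLEdge (n : ℕ) : HLVar n → HLVar n → Set where
  e12 : ∀ k → HLEdge n (k , x1) (k , x2)
  e13 : ∀ k → HLEdge n (k , x1) (k , x3)
  e24 : ∀ k → HLEdge n (k , x2) (k , x4)
  e36 : ∀ k → HLEdge n (k , x3) (k , x6)
  e45 : ∀ k → HLEdge n (k , x4) (k , x5)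
  e65 : ∀ k → HLEdge n (k , x6) (k , x5)
  e47 : ∀ k → HLEdge n (k , x4) (k , x7)
  e67 : ∀ k → HLEdge n (k , x6) (k , x7)
  e57 : ∀ k → HLEdge n (k , x5) (k , x7)
  -- {(k,7),(k-1,1)} for k ≥ 2: here k = j+1 in 1-indexed terms
  chain : ∀ k j → toℕ k ≡ sucℕ (toℕ j) → HLEdge n (k , x7) (j , x1)

-- Lower bound: in the first gadget the vertex sets {1,2,3,4}, {5}, {6}, {7} are connected and pairwise
-- adjacent, a K₄ minor. In a path decomposition the bags meeting a connected vertex set form an interval,
-- and pairwise intersecting intervals on a line have a common point (Helly), so one bag meets all four sets.
-- Upper bound: gadget k is laid out on the block of bags 4k, …, 4k+3, every variable occupying an interval
-- of bags; only variable 1 reaches into the next block, where it meets variable 7 of the next gadget.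

module Submission where

open import Defs

open import Level using (Level; _⊔_)
open import Function using (_∘_)
open import Data.Empty using (⊥-elim)
open import Data.Product using (_×_; _,_; ∃; proj₁; proj₂)
open import Data.Sum using (_⊎_; inj₁; inj₂)
open import Data.Nat as ℕ using (ℕ; suc; _+_; _*_; _≤_; _<_; _≥_; _≤?_; z≤n; s≤s; s≤s⁻¹; NonZero)
open import Data.Nat.Properties
  using (≤-refl; ≤-reflexive; ≤-trans; ≤-antisym; m≤m+n; n≤1+n; n≤0⇒n≡0; m≤n⇒m<n∨m≡n; suc-injective;
         +-comm; +-assoc; +-identityʳ; +-monoʳ-≤; +-monoʳ-<; +-cancelˡ-≤; *-suc; *-cancelˡ-<; *-cancelˡ-≤;
         module ≤-Reasoning)
open import Data.Fin as Fin using (Fin; toℕ; combine; remQuot; inject₁; #_)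
open import Data.Fin.Properties
  using (≤-total; all?; any?; injective⇒≤; toℕ-injective; toℕ-inject₁; toℕ<n; toℕ-combine; combine-remQuot)
open import Data.Vec as Vec using ([]; _∷_)
open import Data.List using (List; []; _∷_; _++_; length; lookup; filter; map; allFin; cartesianProduct)
open import Data.List.Membership.Propositional using (_∈_; find)
open import Data.List.Membership.Propositional.Properties
  using (∈-lookup; ∈-filter⁺; ∈-filter⁻; ∈-map⁺; ∈-++⁺ˡ; ∈-++⁺ʳ; ∈-allFin; ∈-cartesianProduct⁺)
open import Data.List.Membership.Setoid.Properties using (index-injective)
open import Data.List.Relation.Binary.Subset.Propositional using (_⊆_)
open import Data.List.Relation.Unary.All as All using (All; []; _∷_)
open import Data.List.Relation.Unary.AllPairs using ([]; _∷_)
open import Data.List.Relation.Unary.Any as Any using (Any; here; there)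
open import Data.List.Relation.Unary.Linked using (Linked; [-]; _∷_)
open import Data.List.Relation.Unary.Unique.Propositional using (Unique)
open import Data.List.Relation.Unary.Unique.Propositional.Properties using (filter⁺; allFin⁺; cartesianProduct⁺)
open import Relation.Binary.Core using (Rel)
open import Relation.Binary.Definitions using (Total)
open import Relation.Binary.PropositionalEquality using (_≡_; _≢_; refl; sym; trans; cong; subst; setoid)
open import Relation.Nullary.Decidable using (True; toWitness; from-yes; _×-dec_; _→-dec_)
open import Relation.Unary using (Pred; Satisfiable; Decidable; _∩_; _∪_)

private variable
  a ℓ p : Level
  A : Set a
  P Q R S : Pred A p

Convex : {A : Set a} → Rel A ℓ → Pred A p → Set (a ⊔ ℓ ⊔ p)
Convex _≤_ P = ∀ {i j k} → i ≤ j → j ≤ k → P i → P k → P j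

module _ {_≤_ : Rel A ℓ} (total : Total _≤_) where

  convex-∩ : Convex _≤_ P → Convex _≤_ Q → Convex _≤_ (P ∩ Q)
  convex-∩ cP cQ i≤j j≤k (Pi , Qi) (Pk , Qk) = cP i≤j j≤k Pi Pk , cQ i≤j j≤k Qi Qk

  convex-∪ : Convex _≤_ P → Convex _≤_ Q → Satisfiable (P ∩ Q) → Convex _≤_ (P ∪ Q)
  convex-∪ cP cQ _ i≤j j≤k (inj₁ Pi) (inj₁ Pk) = inj₁ (cP i≤j j≤k Pi Pk)
  convex-∪ cP cQ _ i≤j j≤k (inj₂ Qi) (inj₂ Qk) = inj₂ (cQ i≤j j≤k Qi Qk)
  convex-∪ cP cQ (m , Pm , Qm) {j = j} i≤j j≤k (inj₁ Pi) (inj₂ Qk) with total j m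
  ... | inj₁ j≤m = inj₁ (cP i≤j j≤m Pi Pm)
  ... | inj₂ m≤j = inj₂ (cQ m≤j j≤k Qm Qk)
  convex-∪ cP cQ (m , Pm , Qm) {j = j} i≤j j≤k (inj₂ Qi) (inj₁ Pk) with total j m
  ... | inj₁ j≤m = inj₂ (cQ i≤j j≤m Qi Qm)
  ... | inj₂ m≤j = inj₁ (cP m≤j j≤k Pm Pk)

  -- The median of the three witnesses lies in all three sets.
  helly₃ : Convex _≤_ P → Convex _≤_ Q → Convex _≤_ R →
           Satisfiable (P ∩ Q) → Satisfiable (Q ∩ R) → Satisfiable (P ∩ R) →
           Satisfiable (P ∩ Q ∩ R)
  helly₃ cP cQ cR (i , Pi , Qi) (j , Qj , Rj) (k , Pk , Rk) with total i j
  ... | inj₁ i≤j with total j k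
  ...   | inj₁ j≤k = j , cP i≤j j≤k Pi Pk , Qj , Rj
  ...   | inj₂ k≤j with total i k
  ...     | inj₁ i≤k = k , Pk , cQ i≤k k≤j Qi Qj , Rk
  ...     | inj₂ k≤i = i , Pi , Qi , cR k≤i i≤j Rk Rj
  helly₃ cP cQ cR (i , Pi , Qi) (j , Qj , Rj) (k , Pk , Rk) | inj₂ j≤i with total i k
  ... | inj₁ i≤k = i , Pi , Qi , cR j≤i i≤k Rj Rk
  ... | inj₂ k≤i with total j k
  ...   | inj₁ j≤k = k , Pk , cQ j≤k k≤i Qj Qi , Rk
  ...   | inj₂ k≤j = j , cP k≤j j≤i Pk Pi , Qj , Rj

  helly₄ : Convex _≤_ P → Convex _≤_ Q → Convex _≤_ R → Convex _≤_ S →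
           Satisfiable (P ∩ Q) → Satisfiable (P ∩ R) → Satisfiable (P ∩ S) →
           Satisfiable (Q ∩ R) → Satisfiable (Q ∩ S) → Satisfiable (R ∩ S) →
           Satisfiable (P ∩ Q ∩ R ∩ S)
  helly₄ cP cQ cR cS PQ PR PS QR QS RS =
    let i , (Pi , Si) , (Qi , _) , (Ri , _) =
          helly₃ (convex-∩ cP cS) (convex-∩ cQ cS) (convex-∩ cR cS)
            (withS (helly₃ cP cQ cS PQ QS PS))
            (withS (helly₃ cQ cR cS QR RS QS))
            (withS (helly₃ cP cR cS PR RS PS))
    in i , Pi , Qi , Ri , Si
    where
    withS : ∀ {x y} {X : Pred _ x} {Y : Pred _ y} →
            Satisfiable (X ∩ Y ∩ S) → Satisfiable ((X ∩ S) ∩ (Y ∩ S))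
    withS (i , Xi , Yi , Si) = i , (Xi , Si) , (Yi , Si)

lookup-injective : ∀ {xs : List A} → Unique xs → ∀ {i j} → lookup xs i ≡ lookup xs j → i ≡ j
lookup-injective (_ ∷ _)    {Fin.zero}  {Fin.zero}  _  = refl
lookup-injective (x∉ ∷ _)   {Fin.zero}  {Fin.suc j} eq = ⊥-elim (All.lookup x∉ (∈-lookup j) eq)
lookup-injective (x∉ ∷ _)   {Fin.suc i} {Fin.zero}  eq = ⊥-elim (All.lookup x∉ (∈-lookup i) (sym eq))
lookup-injective (_ ∷ uniq) {Fin.suc i} {Fin.suc j} eq = cong Fin.suc (lookup-injective uniq eq)

unique-⊆⇒length≤ : ∀ {xs ys : List A} → Unique xs → xs ⊆ ys → length xs ≤ length ys
unique-⊆⇒length≤ uniq xs⊆ys = injective⇒≤ λ {i} {j} eq →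
  lookup-injective uniq (index-injective (setoid _) (xs⊆ys (∈-lookup i)) (xs⊆ys (∈-lookup j)) eq)

module _ {a b} {V : Set a} {E : V → V → Set b} (D : PathDecomposition V E) where

  SharesBag : Rel V a
  SharesBag u v = ∃ λ i → u ∈ bag D i × v ∈ bag D i

  Meets : List V → Pred (Fin (len D)) a
  Meets vs i = Any (_∈ bag D i) vs

  walk-meets-convex : ∀ {vs} → Linked SharesBag vs → Convex Fin._≤_ (Meets vs)
  walk-meets-convex [-] i≤j j≤k (here vi) (here vk) = here (contiguous D _ i≤j j≤k vi vk)
  walk-meets-convex (u~v ∷ walk) i≤j j≤k ui uk =
    Any.fromSum (convex-∪ ≤-total (contiguous D _) (walk-meets-convex walk) (shares⇒meets u~v)
                  i≤j j≤k (Any.toSum ui) (Any.toSum uk))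
    where
    shares⇒meets : ∀ {u v vs} → SharesBag u v → Satisfiable ((u ∈_) ∘ bag D ∩ Meets (v ∷ vs))
    shares⇒meets (i , ui , vi) = i , ui , here vi

module IntervalModel {a b} {V : Set a} {E : V → V → Set b}
  (vertices : List V) (vertices-unique : Unique vertices) (∈-vertices : ∀ v → v ∈ vertices)
  (lo hi : V → ℕ) where

  Spans : V → ℕ → Set
  Spans v p = lo v ≤ p × p ≤ hi v

  spans? : ∀ p → Decidable (λ v → Spans v p)
  spans? p v = lo v ≤? p ×-dec p ≤? hi v

  bagAt : ∀ {len} → Fin len → List V
  bagAt i = filter (spans? (toℕ i)) vertices

  ∈-bagAt⁺ : ∀ {len v} {i : Fin len} → Spans v (toℕ i) → v ∈ bagAt i
  ∈-bagAt⁺ {v = v} = ∈-filter⁺ (spans? _) (∈-vertices v)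

  ∈-bagAt⁻ : ∀ {len v} {i : Fin len} → v ∈ bagAt i → Spans v (toℕ i)
  ∈-bagAt⁻ v∈ = proj₂ (∈-filter⁻ (spans? _) {xs = vertices} v∈)

  module _ (len : ℕ)
    (covers-v : ∀ v → ∃ λ (i : Fin len) → Spans v (toℕ i))
    (covers-e : ∀ u v → E u v → ∃ λ (i : Fin len) → Spans u (toℕ i) × Spans v (toℕ i)) where

    intervalDecomposition : PathDecomposition V E
    intervalDecomposition = record
      { len             = len
      ; bag             = bagAt
      ; bag-unique      = λ _ → filter⁺ (spans? _) vertices-unique
      ; covers-vertices = λ v → let i , v∼i = covers-v v in i , ∈-bagAt⁺ v∼i
      ; covers-edges    = λ u v e → let i , u∼i , v∼i = covers-e u v e in i , ∈-bagAt⁺ u∼i , ∈-bagAt⁺ v∼i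
      ; contiguous      = λ v i≤j j≤k vi vk →
          ∈-bagAt⁺ (≤-trans (proj₁ (∈-bagAt⁻ vi)) i≤j , ≤-trans j≤k (proj₂ (∈-bagAt⁻ vk)))
      }

    intervalDecomposition-width : ∀ w →
      (∀ (i : Fin len) → ∃ λ ys → length ys ≤ suc w × (∀ {v} → Spans v (toℕ i) → v ∈ ys)) →
      WidthAtMost intervalDecomposition w
    intervalDecomposition-width w cover i =
      let ys , |ys|≤ , spans⇒∈ = cover i
      in ≤-trans (unique-⊆⇒length≤ (filter⁺ (spans? _) vertices-unique) (spans⇒∈ ∘ ∈-bagAt⁻)) |ys|≤

module _ (b : ℕ) where
  open ≤-Reasoning

  b*k′+c≤b*k+r⇒k′≤k : ∀ {k k′ r c} → r < b → b * k′ + c ≤ b * k + r → k′ ≤ k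
  b*k′+c≤b*k+r⇒k′≤k {k} {k′} {r} {c} r<b le = s≤s⁻¹ (*-cancelˡ-< b k′ (suc k) (begin-strict
    b * k′      ≤⟨ m≤m+n (b * k′) c ⟩
    b * k′ + c  ≤⟨ le ⟩
    b * k + r   <⟨ +-monoʳ-< (b * k) r<b ⟩
    b * k + b   ≡⟨ +-comm (b * k) b ⟩
    b + b * k   ≡⟨ *-suc b k ⟨
    b * suc k   ∎))

  b*k+r≤b*k′+d⇒k≤1+k′ : ∀ .{{_ : NonZero b}} {k k′ r d} → d ≤ b → b * k + r ≤ b * k′ + d → k ≤ suc k′
  b*k+r≤b*k′+d⇒k≤1+k′ {k} {k′} {r} {d} d≤b le = *-cancelˡ-≤ b (begin
    b * k        ≤⟨ m≤m+n (b * k) r ⟩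
    b * k + r    ≤⟨ le ⟩
    b * k′ + d   ≤⟨ +-monoʳ-≤ (b * k′) d≤b ⟩
    b * k′ + b   ≡⟨ +-comm (b * k′) b ⟩
    b + b * k′   ≡⟨ *-suc b k′ ⟨
    b * suc k′   ∎)

  same-or-next-block : ∀ .{{_ : NonZero b}} {k k′ r c d} → r < b → d ≤ b →
                   b * k′ + c ≤ b * k + r → b * k + r ≤ b * k′ + d →
                   (k ≡ k′ × c ≤ r × r ≤ d) ⊎ (k ≡ suc k′ × r ≡ 0 × d ≡ b)
  same-or-next-block {k} {k′} {r} {c} {d} r<b d≤b lo≤p p≤hi
    with m≤n⇒m<n∨m≡n (b*k+r≤b*k′+d⇒k≤1+k′ d≤b p≤hi)
  ... | inj₁ k<1+k′ with refl ← ≤-antisym (s≤s⁻¹ k<1+k′) (b*k′+c≤b*k+r⇒k′≤k r<b lo≤p)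
    = inj₁ (refl , +-cancelˡ-≤ (b * k) c r lo≤p , +-cancelˡ-≤ (b * k) r d p≤hi)
  ... | inj₂ refl = inj₂ (refl , n≤0⇒n≡0 r≤0 , ≤-antisym d≤b (≤-trans (m≤m+n b r) b+r≤d))
    where
    b+r≤d : b + r ≤ d
    b+r≤d = +-cancelˡ-≤ (b * k′) (b + r) d (begin
      b * k′ + (b + r)  ≡⟨ +-assoc (b * k′) b r ⟨
      b * k′ + b + r    ≡⟨ cong (_+ r) (+-comm (b * k′) b) ⟩
      b + b * k′ + r    ≡⟨ cong (_+ r) (*-suc b k′) ⟨
      b * suc k′ + r    ≤⟨ p≤hi ⟩
      b * k′ + d        ∎)
    r≤0 : r ≤ 0
    r≤0 = +-cancelˡ-≤ b r 0 (begin
      b + r  ≤⟨ b+r≤d ⟩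
      d      ≤⟨ d≤b ⟩
      b      ≡⟨ +-identityʳ b ⟨
      b + 0  ∎)

module _ {m} (D : PathDecomposition (HLVar (suc m)) (HLEdge (suc m))) where
  private
    v : Fin 7 → HLVar (suc m)
    v = Fin.zero ,_

    branch : List (HLVar (suc m))
    branch = v x4 ∷ v x2 ∷ v x1 ∷ v x3 ∷ []

    edge : ∀ {u w} → HLEdge (suc m) u w → SharesBag D u w
    edge = covers-edges D _ _

    edge˘ : ∀ {u w} → HLEdge (suc m) u w → SharesBag D w u
    edge˘ e = let i , u∈ , w∈ = edge e in i , w∈ , u∈

    branch-walk : Linked (SharesBag D) branch
    branch-walk = edge˘ (e24 Fin.zero) ∷ edge˘ (e12 Fin.zero) ∷ edge (e13 Fin.zero) ∷ [-]

    branch-avoids : ∀ {w} → w ∈ branch → All (w ≢_) (v x5 ∷ v x7 ∷ v x6 ∷ [])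
    branch-avoids (here refl)                        = (λ ()) ∷ (λ ()) ∷ (λ ()) ∷ []
    branch-avoids (there (here refl))                = (λ ()) ∷ (λ ()) ∷ (λ ()) ∷ []
    branch-avoids (there (there (here refl)))        = (λ ()) ∷ (λ ()) ∷ (λ ()) ∷ []
    branch-avoids (there (there (there (here refl)))) = (λ ()) ∷ (λ ()) ∷ (λ ()) ∷ []

  first-gadget-needs-bag-of-four : ∃ λ t → 4 ≤ length (bag D t)
  first-gadget-needs-bag-of-four =
    let t , meets , 5∈ , 7∈ , 6∈ =
          helly₄ ≤-total (walk-meets-convex D branch-walk)
            (contiguous D (v x5)) (contiguous D (v x7)) (contiguous D (v x6))
            (meets-head (edge (e45 Fin.zero))) (meets-head (edge (e47 Fin.zero)))
            (meets-last (edge (e36 Fin.zero)))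
            (edge (e57 Fin.zero)) (edge˘ (e65 Fin.zero)) (edge˘ (e67 Fin.zero))
        w , w∈branch , w∈ = find meets
    in t , unique-⊆⇒length≤ (branch-avoids w∈branch ∷ ((λ ()) ∷ (λ ()) ∷ []) ∷ ((λ ()) ∷ []) ∷ [] ∷ [])
                            (All.lookup (w∈ ∷ 5∈ ∷ 7∈ ∷ 6∈ ∷ []))
    where
    meets-head : ∀ {u} → SharesBag D (v x4) u → Satisfiable (Meets D branch ∩ (u ∈_) ∘ bag D)
    meets-head (i , 4∈ , u∈) = i , here 4∈ , u∈
    meets-last : ∀ {u} → SharesBag D (v x3) u → Satisfiable (Meets D branch ∩ (u ∈_) ∘ bag D)
    meets-last (i , 3∈ , u∈) = i , there (there (there (here 3∈))) , u∈

width≥3 : ∀ {m} (D : PathDecomposition (HLVar (suc m)) (HLEdge (suc m))) w → WidthAtMost D w → 3 ≤ w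
width≥3 D w width = let t , 4≤|t| = first-gadget-needs-bag-of-four D in s≤s⁻¹ (≤-trans 4≤|t| (width t))

-- Variable x of gadget k occupies the bags 4k + enter x, …, 4k + leave x, so block k consists of
-- {(k,7),(k-1,1)}, {(k,4),(k,5),(k,6),(k,7)}, {(k,2),(k,3),(k,4),(k,6)} and {(k,1),(k,2),(k,3)}.
enter leave : Fin 7 → ℕ
enter = Vec.lookup (3 ∷ 2 ∷ 2 ∷ 1 ∷ 1 ∷ 1 ∷ 0 ∷ [])
leave = Vec.lookup (4 ∷ 3 ∷ 3 ∷ 2 ∷ 1 ∷ 2 ∷ 1 ∷ [])

Occupies : Fin 4 → Fin 7 → Set
Occupies r x = enter x ≤ toℕ r × toℕ r ≤ leave x

occupies? : ∀ r → Decidable (Occupies r)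
occupies? r x = enter x ≤? toℕ r ×-dec toℕ r ≤? leave x

occupies-some-bag : ∀ x → ∃ λ r → Occupies r x
occupies-some-bag = from-yes (all? λ x → any? λ r → occupies? r x)

leave≤4 : ∀ x → leave x ≤ 4
leave≤4 = from-yes (all? λ x → leave x ≤? 4)

leave≡4⇒x1 : ∀ x → leave x ≡ 4 → x ≡ x1
leave≡4⇒x1 = from-yes (all? λ x → leave x ℕ.≟ 4 →-dec x Fin.≟ x1)

module BlockLayout (n : ℕ) where

  lo hi : HLVar n → ℕ
  lo (k , x) = 4 * toℕ k + enter x
  hi (k , x) = 4 * toℕ k + leave x

  open IntervalModel {E = HLEdge n} (cartesianProduct (allFin n) (allFin 7))
    (cartesianProduct⁺ (allFin⁺ n) (allFin⁺ 7)) (λ (k , x) → ∈-cartesianProduct⁺ (∈-allFin k) (∈-allFin x))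
    lo hi

  spans-occupied : ∀ k r x → Occupies r x → Spans (k , x) (toℕ (combine k r))
  spans-occupied k r x (e≤r , r≤l) rewrite toℕ-combine k r =
    +-monoʳ-≤ (4 * toℕ k) e≤r , +-monoʳ-≤ (4 * toℕ k) r≤l

  shared-bag : ∀ k r x y → {True (occupies? r x)} → {True (occupies? r y)} →
               ∃ λ (i : Fin (n * 4)) → Spans (k , x) (toℕ i) × Spans (k , y) (toℕ i)
  shared-bag k r x y {x∼r} {y∼r} =
    combine k r , spans-occupied k r x (toWitness x∼r) , spans-occupied k r y (toWitness y∼r)

  spans-chain : ∀ {k j : Fin n} → toℕ k ≡ suc (toℕ j) → Spans (j , x1) (toℕ (combine k (Fin.zero {3})))
  spans-chain {k} {j} k≡1+j rewrite toℕ-combine k (Fin.zero {3}) | k≡1+j =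
    ≤-trans (+-monoʳ-≤ (4 * toℕ j) (n≤1+n 3)) (≤-reflexive (sym next-block)) , ≤-reflexive next-block
    where
    next-block : 4 * suc (toℕ j) + 0 ≡ 4 * toℕ j + 4
    next-block = trans (+-identityʳ _) (trans (*-suc 4 (toℕ j)) (+-comm 4 (4 * toℕ j)))

  covers-variables : ∀ v → ∃ λ (i : Fin (n * 4)) → Spans v (toℕ i)
  covers-variables (k , x) = let r , x∼r = occupies-some-bag x in combine k r , spans-occupied k r x x∼r

  covers-constraints : ∀ u v → HLEdge n u v → ∃ λ (i : Fin (n * 4)) → Spans u (toℕ i) × Spans v (toℕ i)
  covers-constraints _ _ (e12 k) = shared-bag k (# 3) x1 x2
  covers-constraints _ _ (e13 k) = shared-bag k (# 3) x1 x3
  covers-constraints _ _ (e24 k) = shared-bag k (# 2) x2 x4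
  covers-constraints _ _ (e36 k) = shared-bag k (# 2) x3 x6
  covers-constraints _ _ (e45 k) = shared-bag k (# 1) x4 x5
  covers-constraints _ _ (e65 k) = shared-bag k (# 1) x6 x5
  covers-constraints _ _ (e47 k) = shared-bag k (# 1) x4 x7
  covers-constraints _ _ (e67 k) = shared-bag k (# 1) x6 x7
  covers-constraints _ _ (e57 k) = shared-bag k (# 1) x5 x7
  covers-constraints _ _ (chain k j k≡1+j) =
    combine k Fin.zero , spans-occupied k Fin.zero x7 (z≤n , z≤n) , spans-chain k≡1+j

  -- Splitting on r first lets carried k r compute to [] for r ≠ 0 and unknown k.
  carried : Fin n → Fin 4 → List (HLVar n)
  carried _           (Fin.suc _) = []
  carried Fin.zero    Fin.zero    = []
  carried (Fin.suc k) Fin.zero    = (inject₁ k , x1) ∷ []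

  carried∈ : ∀ {k j} → toℕ k ≡ suc (toℕ j) → (j , x1) ∈ carried k Fin.zero
  carried∈ {Fin.suc k} k≡1+j =
    here (cong (_, x1) (toℕ-injective (trans (sym (suc-injective k≡1+j)) (sym (toℕ-inject₁ k)))))

  blockBag : Fin n → Fin 4 → List (HLVar n)
  blockBag k r = map (k ,_) (filter (occupies? r) (allFin 7)) ++ carried k r

  blockBag-length : ∀ k r → length (blockBag k r) ≤ 4
  blockBag-length Fin.zero    Fin.zero                               = s≤s z≤n
  blockBag-length (Fin.suc _) Fin.zero                               = s≤s (s≤s z≤n)
  blockBag-length _           (Fin.suc Fin.zero)                     = ≤-refl
  blockBag-length _           (Fin.suc (Fin.suc Fin.zero))           = ≤-refl
  blockBag-length _           (Fin.suc (Fin.suc (Fin.suc Fin.zero))) = s≤s (s≤s (s≤s z≤n))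

  blockBag-covers : ∀ k r {v} → Spans v (4 * toℕ k + toℕ r) → v ∈ blockBag k r
  blockBag-covers k r {k′ , x} (lo≤p , p≤hi) with same-or-next-block 4 (toℕ<n r) (leave≤4 x) lo≤p p≤hi
  ... | inj₁ (k≡k′ , x∼r) with refl ← toℕ-injective {i = k} {j = k′} k≡k′ =
    ∈-++⁺ˡ (∈-map⁺ (k ,_) (∈-filter⁺ (occupies? r) (∈-allFin x) x∼r))
  ... | inj₂ (k≡1+k′ , r≡0 , leave≡4)
    with refl ← leave≡4⇒x1 x leave≡4 | refl ← toℕ-injective {i = r} {j = Fin.zero} r≡0 =
    ∈-++⁺ʳ _ (carried∈ k≡1+k′)

  position-cover : ∀ (i : Fin (n * 4)) → ∃ λ ys → length ys ≤ 4 × (∀ {v} → Spans v (toℕ i) → v ∈ ys)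
  position-cover i =
    let k , r = remQuot {n} 4 i
        i≡4k+r = trans (cong toℕ (sym (combine-remQuot {n} 4 i))) (toℕ-combine k r)
    in blockBag k r , blockBag-length k r , λ {v} → blockBag-covers k r ∘ subst (Spans v) i≡4k+r

  decomposition : PathDecomposition (HLVar n) (HLEdge n)
  decomposition = intervalDecomposition (n * 4) covers-variables covers-constraints

  decomposition-width : WidthAtMost decomposition 3
  decomposition-width =
    intervalDecomposition-width (n * 4) covers-variables covers-constraints 3 position-cover

proposition6p2 : ∀ (n : ℕ) → n ≥ 1 → PathwidthIs (HLVar n) (HLEdge n) 3
proposition6p2 (suc m) _ = (decomposition , decomposition-width) , width≥3
  where open BlockLayout (suc m)
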